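{- For non-negative integers $j$ and $u$ with $j\geq u$, \[ \sum_{\mu=0}^{j-u}\binom{2j+1-u}{\mu}\sum_{\nu=0}^{j}\binom{2j+1-u-\mu}{\nu}(-2)^{2j+1-u-\mu-\nu} =(-1)^{j+1}\binom{2j-u}{j}\left\{1+(-1)^{ -u}\right\}. \] -}

module Defs where

open import Data.Nat using (ℕ; zero; suc)
open import Data.Integer using (ℤ; _+_; _*_; -_; +_)

-- ∑[ i ≤ n ] f i  =  f 0 + f 1 + … + f n   (inclusive upper bound)
sumTo : ℕ → (ℕ → ℤ) → ℤ
sumTo zero    f = f 0
sumTo (suc n) f = sumTo n f + f (suc n)

_^ᶻ_ : ℤ → ℕ → ℤ
x ^ᶻ zero  = + 1
x ^ᶻ suc n = x * (x ^ᶻ n)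

-- Write N = a + b + 1.  For each μ the inner sum is the binomial expansion of
-- (1 + (−2))^(N − μ) = (−1)^(N − μ) truncated after ν = b.  The missing tail,
-- a double sum over μ ≤ a and ν > b, is turned by C(N,μ) C(N−μ,ν) = C(N,ν) C(N−ν,μ)
-- into sums over μ ≤ a that are complete expansions, since N − ν ≤ a.  What remains
-- are partial alternating sums Σ_{μ ≤ a} C(n+1,μ) (−1)^(n+1−μ) = −C(n,a) (−1)^(n−a),
-- and for a = j − u, b = j the two that occur combine to the right-hand side
-- because C(2j−u, j−u) = C(2j−u, j) and (−1)^(j−u) = (−1)^j (−1)^u.
module Submission where

open import Defs
open import Data.Nat using (ℕ; zero; suc; _≤_; _<_; _∸_; _!; z≤n; s≤s; _≤?_; _<?_; NonZero)
  renaming (_+_ to _+ℕ_; _*_ to _*ℕ_)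
import Data.Nat.Properties as ℕₚ
open import Data.Nat.Properties using (_!≢0; _!*_!≢0)
import Data.Nat.Tactic.RingSolver as ℕ-Solver
open import Data.Nat.DivMod using (_/_; m/n*n≡m)
open import Data.Nat.Combinatorics
  using (_C_; nCk+nC[k+1]≡[n+1]C[k+1]; k>n⇒nCk≡0; nCk≡nC[n∸k]; k![n∸k]!∣n!)
open import Data.Nat.Combinatorics.Specification using (nCk≡n!/k![n-k]!)
open import Data.Integer using (ℤ; _+_; _*_; _-_; -_; +_)
import Data.Integer.Properties as ℤₚ
open import Data.Integer.Tactic.RingSolver using (solve-∀)
open import Relation.Binary.PropositionalEquality
open import Relation.Nullary using (yes; no)

open ≡-Reasoning

sumTo-cong : ∀ n {f g : ℕ → ℤ} → (∀ i → f i ≡ g i) → sumTo n f ≡ sumTo n g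
sumTo-cong zero    f≗g = f≗g 0
sumTo-cong (suc n) f≗g = cong₂ _+_ (sumTo-cong n f≗g) (f≗g (suc n))

sumTo-distrib-+ : ∀ n (f g : ℕ → ℤ) → sumTo n (λ i → f i + g i) ≡ sumTo n f + sumTo n g
sumTo-distrib-+ zero    f g = refl
sumTo-distrib-+ (suc n) f g rewrite sumTo-distrib-+ n f g =
  interchange (sumTo n f) (sumTo n g) (f (suc n)) (g (suc n))
  where
  interchange : ∀ a b c d → a + b + (c + d) ≡ a + c + (b + d)
  interchange = solve-∀

*-distribˡ-sumTo : ∀ n c (f : ℕ → ℤ) → c * sumTo n f ≡ sumTo n (λ i → c * f i)
*-distribˡ-sumTo zero    c f = refl
*-distribˡ-sumTo (suc n) c f rewrite sym (*-distribˡ-sumTo n c f) =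
  ℤₚ.*-distribˡ-+ c (sumTo n f) (f (suc n))

sumTo-suc : ∀ n (f : ℕ → ℤ) → sumTo (suc n) f ≡ f 0 + sumTo n (λ i → f (suc i))
sumTo-suc zero    f = refl
sumTo-suc (suc n) f rewrite sumTo-suc n f = ℤₚ.+-assoc (f 0) _ _

sumTo-split : ∀ m k (f : ℕ → ℤ) →
  sumTo (suc (m +ℕ k)) f ≡ sumTo m f + sumTo k (λ i → f (suc (m +ℕ i)))
sumTo-split m zero    f rewrite ℕₚ.+-identityʳ m = refl
sumTo-split m (suc k) f rewrite ℕₚ.+-suc m k | sumTo-split m k f = ℤₚ.+-assoc (sumTo m f) _ _

sumTo-swap : ∀ m n (f : ℕ → ℕ → ℤ) →
  sumTo m (λ i → sumTo n (f i)) ≡ sumTo n (λ j → sumTo m (λ i → f i j))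
sumTo-swap zero    n f = refl
sumTo-swap (suc m) n f rewrite sumTo-swap m n f =
  sym (sumTo-distrib-+ n (λ j → sumTo m (λ i → f i j)) (f (suc m)))

^ᶻ-distribˡ-+-* : ∀ x m n → x ^ᶻ (m +ℕ n) ≡ x ^ᶻ m * x ^ᶻ n
^ᶻ-distribˡ-+-* x zero    n = sym (ℤₚ.*-identityˡ _)
^ᶻ-distribˡ-+-* x (suc m) n rewrite ^ᶻ-distribˡ-+-* x m n = sym (ℤₚ.*-assoc x _ _)

-1^n*-1^n≡1 : ∀ n → (- (+ 1)) ^ᶻ n * (- (+ 1)) ^ᶻ n ≡ + 1
-1^n*-1^n≡1 zero    = refl
-1^n*-1^n≡1 (suc n) = trans (square-neg ((- (+ 1)) ^ᶻ n)) (-1^n*-1^n≡1 n)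
  where
  square-neg : ∀ x → (- (+ 1) * x) * (- (+ 1) * x) ≡ x * x
  square-neg = solve-∀

∸-comm : ∀ m n o → m ∸ n ∸ o ≡ m ∸ o ∸ n
∸-comm m n o = begin
  m ∸ n ∸ o   ≡⟨ ℕₚ.∸-+-assoc m n o ⟩
  m ∸ (n +ℕ o) ≡⟨ cong (m ∸_) (ℕₚ.+-comm n o) ⟩
  m ∸ (o +ℕ n) ≡⟨ ℕₚ.∸-+-assoc m o n ⟨
  m ∸ o ∸ n   ∎

nCk*k!*[n∸k]!≡n! : ∀ {n k} → k ≤ n → (n C k) *ℕ (k ! *ℕ (n ∸ k) !) ≡ n !
nCk*k!*[n∸k]!≡n! {n} {k} k≤n = begin
  (n C k) *ℕ (k ! *ℕ (n ∸ k) !)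
    ≡⟨ cong (_*ℕ (k ! *ℕ (n ∸ k) !)) (nCk≡n!/k![n-k]! k≤n) ⟩
  (n ! / (k ! *ℕ (n ∸ k) !)) {{k !* (n ∸ k) !≢0}} *ℕ (k ! *ℕ (n ∸ k) !)
    ≡⟨ m/n*n≡m {{k !* (n ∸ k) !≢0}} (k![n∸k]!∣n! k≤n) ⟩
  n ! ∎

trinomial-factorial : ∀ N μ ν → μ +ℕ ν ≤ N →
  (N C μ) *ℕ ((N ∸ μ) C ν) *ℕ (μ ! *ℕ (ν ! *ℕ (N ∸ μ ∸ ν) !)) ≡ N !
trinomial-factorial N μ ν μ+ν≤N = begin
  (N C μ) *ℕ ((N ∸ μ) C ν) *ℕ (μ ! *ℕ (ν ! *ℕ (N ∸ μ ∸ ν) !))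
    ≡⟨ regroup (N C μ) ((N ∸ μ) C ν) (μ !) (ν !) ((N ∸ μ ∸ ν) !) ⟩
  (N C μ) *ℕ μ ! *ℕ (((N ∸ μ) C ν) *ℕ (ν ! *ℕ (N ∸ μ ∸ ν) !))
    ≡⟨ cong ((N C μ) *ℕ μ ! *ℕ_) (nCk*k!*[n∸k]!≡n! (ℕₚ.m+n≤o⇒m≤o∸n ν (subst (_≤ N) (ℕₚ.+-comm μ ν) μ+ν≤N))) ⟩
  (N C μ) *ℕ μ ! *ℕ (N ∸ μ) !
    ≡⟨ ℕₚ.*-assoc (N C μ) (μ !) ((N ∸ μ) !) ⟩
  (N C μ) *ℕ (μ ! *ℕ (N ∸ μ) !)
    ≡⟨ nCk*k!*[n∸k]!≡n! (ℕₚ.m+n≤o⇒m≤o μ μ+ν≤N) ⟩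
  N ! ∎
  where
  regroup : ∀ c d x y z → c *ℕ d *ℕ (x *ℕ (y *ℕ z)) ≡ c *ℕ x *ℕ (d *ℕ (y *ℕ z))
  regroup = ℕ-Solver.solve-∀

C*C≡0 : ∀ N μ ν → N < μ +ℕ ν → (N C μ) *ℕ ((N ∸ μ) C ν) ≡ 0
C*C≡0 N μ ν N<μ+ν with μ ≤? N
... | yes μ≤N = trans (cong ((N C μ) *ℕ_) (k>n⇒nCk≡0 N∸μ<ν)) (ℕₚ.*-zeroʳ (N C μ))
  where
  N∸μ<ν : N ∸ μ < ν
  N∸μ<ν = subst (N ∸ μ <_) (ℕₚ.m+n∸m≡n μ ν) (ℕₚ.∸-monoˡ-< N<μ+ν μ≤N)
... | no μ≰N rewrite k>n⇒nCk≡0 (ℕₚ.≰⇒> μ≰N) = refl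

C*C-comm : ∀ N μ ν → (N C μ) *ℕ ((N ∸ μ) C ν) ≡ (N C ν) *ℕ ((N ∸ ν) C μ)
C*C-comm N μ ν with μ +ℕ ν ≤? N
... | no μ+ν≰N = trans (C*C≡0 N μ ν N<μ+ν) (sym (C*C≡0 N ν μ (subst (N <_) (ℕₚ.+-comm μ ν) N<μ+ν)))
  where
  N<μ+ν : N < μ +ℕ ν
  N<μ+ν = ℕₚ.≰⇒> μ+ν≰N
... | yes μ+ν≤N = ℕₚ.*-cancelʳ-≡ _ _ (μ ! *ℕ (ν ! *ℕ (N ∸ μ ∸ ν) !)) {{denominator≢0}}
  (trans (trinomial-factorial N μ ν μ+ν≤N)
    (sym (trans (cong ((N C ν) *ℕ ((N ∸ ν) C μ) *ℕ_) denominator-sym)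
                (trinomial-factorial N ν μ (subst (_≤ N) (ℕₚ.+-comm μ ν) μ+ν≤N)))))
  where
  denominator≢0 : NonZero (μ ! *ℕ (ν ! *ℕ (N ∸ μ ∸ ν) !))
  denominator≢0 = ℕₚ.m*n≢0 (μ !) (ν ! *ℕ (N ∸ μ ∸ ν) !) {{μ !≢0}} {{ν !* (N ∸ μ ∸ ν) !≢0}}
  denominator-sym : μ ! *ℕ (ν ! *ℕ (N ∸ μ ∸ ν) !) ≡ ν ! *ℕ (μ ! *ℕ (N ∸ ν ∸ μ) !)
  denominator-sym rewrite ∸-comm N μ ν = exchange (μ !) (ν !) ((N ∸ ν ∸ μ) !)
    where
    exchange : ∀ x y z → x *ℕ (y *ℕ z) ≡ y *ℕ (x *ℕ z)
    exchange = ℕ-Solver.solve-∀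

binomialTerm : ℤ → ℕ → ℕ → ℤ
binomialTerm y M ν = + (M C ν) * y ^ᶻ (M ∸ ν)

binomialTerm-suc : ∀ y M ν →
  binomialTerm y (suc M) (suc ν) ≡ binomialTerm y M ν + y * binomialTerm y M (suc ν)
binomialTerm-suc y M ν = begin
  + (suc M C suc ν) * y ^ᶻ (M ∸ ν)
    ≡⟨ cong (λ c → c * y ^ᶻ (M ∸ ν)) pascal ⟩
  (+ (M C ν) + + (M C suc ν)) * y ^ᶻ (M ∸ ν)
    ≡⟨ ℤₚ.*-distribʳ-+ (y ^ᶻ (M ∸ ν)) (+ (M C ν)) (+ (M C suc ν)) ⟩
  binomialTerm y M ν + + (M C suc ν) * y ^ᶻ (M ∸ ν)
    ≡⟨ cong (λ s → binomialTerm y M ν + s) lower ⟩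
  binomialTerm y M ν + y * binomialTerm y M (suc ν) ∎
  where
  pascal : + (suc M C suc ν) ≡ + (M C ν) + + (M C suc ν)
  pascal = trans (cong +_ (sym (nCk+nC[k+1]≡[n+1]C[k+1] M ν))) (ℤₚ.pos-+ (M C ν) (M C suc ν))
  -- For ν ≥ M the coefficient C(M, ν+1) vanishes, so the exponent M ∸ ν is irrelevant.
  lower : + (M C suc ν) * y ^ᶻ (M ∸ ν) ≡ y * binomialTerm y M (suc ν)
  lower with ν <? M
  ... | yes ν<M rewrite ℕₚ.+-∸-assoc 1 ν<M = swap-factors (+ (M C suc ν)) y (y ^ᶻ (M ∸ suc ν))
    where
    swap-factors : ∀ c y z → c * (y * z) ≡ y * (c * z)
    swap-factors = solve-∀
  ... | no ν≮M rewrite k>n⇒nCk≡0 {M} {suc ν} (s≤s (ℕₚ.≮⇒≥ ν≮M)) = sym (ℤₚ.*-zeroʳ y)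

binomial-sumTo : ∀ y M n → M ≤ n → sumTo n (binomialTerm y M) ≡ (+ 1 + y) ^ᶻ M
binomial-sumTo y zero zero    _ = refl
binomial-sumTo y zero (suc n) _ rewrite binomial-sumTo y zero n z≤n | k>n⇒nCk≡0 {0} {suc n} (s≤s z≤n) = refl
binomial-sumTo y (suc M) (suc n) (s≤s M≤n) = begin
  sumTo (suc n) (binomialTerm y (suc M))
    ≡⟨ sumTo-suc n (binomialTerm y (suc M)) ⟩
  + 1 * (y * y ^ᶻ M) + sumTo n (λ ν → binomialTerm y (suc M) (suc ν))
    ≡⟨ cong (λ s → + 1 * (y * y ^ᶻ M) + s) pascal-split ⟩
  + 1 * (y * y ^ᶻ M) + (G + y * R)
    ≡⟨ regroup (y ^ᶻ M) G R y ⟩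
  G + y * (+ 1 * y ^ᶻ M + R)
    ≡⟨ cong (λ s → G + y * s) (sumTo-suc n (binomialTerm y M)) ⟨
  G + y * sumTo (suc n) (binomialTerm y M)
    ≡⟨ cong₂ (λ s t → s + y * t) (binomial-sumTo y M n M≤n) (binomial-sumTo y M (suc n) (ℕₚ.m≤n⇒m≤1+n M≤n)) ⟩
  (+ 1 + y) ^ᶻ M + y * (+ 1 + y) ^ᶻ M
    ≡⟨ factor ((+ 1 + y) ^ᶻ M) y ⟩
  (+ 1 + y) ^ᶻ suc M ∎
  where
  G R : ℤ
  G = sumTo n (binomialTerm y M)
  R = sumTo n (λ ν → binomialTerm y M (suc ν))
  pascal-split : sumTo n (λ ν → binomialTerm y (suc M) (suc ν)) ≡ G + y * R
  pascal-split = begin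
    sumTo n (λ ν → binomialTerm y (suc M) (suc ν))
      ≡⟨ sumTo-cong n (binomialTerm-suc y M) ⟩
    sumTo n (λ ν → binomialTerm y M ν + y * binomialTerm y M (suc ν))
      ≡⟨ sumTo-distrib-+ n _ _ ⟩
    G + sumTo n (λ ν → y * binomialTerm y M (suc ν))
      ≡⟨ cong (λ s → G + s) (*-distribˡ-sumTo n y (λ ν → binomialTerm y M (suc ν))) ⟨
    G + y * R ∎
  regroup : ∀ p s t y → + 1 * (y * p) + (s + y * t) ≡ s + y * (+ 1 * p + t)
  regroup = solve-∀
  factor : ∀ p y → p + y * p ≡ (+ 1 + y) * p
  factor = solve-∀

alternating-sumTo : ∀ n a → sumTo a (binomialTerm (- (+ 1)) (suc n)) ≡ - binomialTerm (- (+ 1)) n a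
alternating-sumTo n zero = first-term ((- (+ 1)) ^ᶻ n)
  where
  first-term : ∀ x → + 1 * (- (+ 1) * x) ≡ - (+ 1 * x)
  first-term = solve-∀
alternating-sumTo n (suc a) = begin
  sumTo a (binomialTerm m1 (suc n)) + binomialTerm m1 (suc n) (suc a)
    ≡⟨ cong₂ _+_ (alternating-sumTo n a) (binomialTerm-suc m1 n a) ⟩
  - binomialTerm m1 n a + (binomialTerm m1 n a + m1 * binomialTerm m1 n (suc a))
    ≡⟨ telescope (binomialTerm m1 n a) (binomialTerm m1 n (suc a)) ⟩
  - binomialTerm m1 n (suc a) ∎
  where
  m1 : ℤ
  m1 = - (+ 1)
  telescope : ∀ s t → - s + (s + - (+ 1) * t) ≡ - t
  telescope = solve-∀

trinomial-sym : ∀ y N μ ν →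
  + (N C μ) * binomialTerm y (N ∸ μ) ν ≡ + (N C ν) * binomialTerm y (N ∸ ν) μ
trinomial-sym y N μ ν = begin
  + (N C μ) * (+ ((N ∸ μ) C ν) * y ^ᶻ (N ∸ μ ∸ ν))
    ≡⟨ ℤₚ.*-assoc (+ (N C μ)) _ _ ⟨
  + (N C μ) * + ((N ∸ μ) C ν) * y ^ᶻ (N ∸ μ ∸ ν)
    ≡⟨ cong₂ _*_ coefficients (cong (y ^ᶻ_) (∸-comm N μ ν)) ⟩
  + (N C ν) * + ((N ∸ ν) C μ) * y ^ᶻ (N ∸ ν ∸ μ)
    ≡⟨ ℤₚ.*-assoc (+ (N C ν)) _ _ ⟩
  + (N C ν) * (+ ((N ∸ ν) C μ) * y ^ᶻ (N ∸ ν ∸ μ)) ∎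
  where
  coefficients : + (N C μ) * + ((N ∸ μ) C ν) ≡ + (N C ν) * + ((N ∸ ν) C μ)
  coefficients = begin
    + (N C μ) * + ((N ∸ μ) C ν)     ≡⟨ ℤₚ.pos-* (N C μ) ((N ∸ μ) C ν) ⟨
    + ((N C μ) *ℕ ((N ∸ μ) C ν))   ≡⟨ cong +_ (C*C-comm N μ ν) ⟩
    + ((N C ν) *ℕ ((N ∸ ν) C μ))   ≡⟨ ℤₚ.pos-* (N C ν) ((N ∸ ν) C μ) ⟩
    + (N C ν) * + ((N ∸ ν) C μ)     ∎

binomial-tail-swap : ∀ y N a b → N ≤ suc (a +ℕ b) →
  sumTo a (λ μ → + (N C μ) * sumTo a (λ i → binomialTerm y (N ∸ μ) (suc (b +ℕ i))))
  ≡ sumTo a (λ i → binomialTerm (+ 1 + y) N (suc (b +ℕ i)))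
binomial-tail-swap y N a b N≤1+a+b = begin
  sumTo a (λ μ → + (N C μ) * sumTo a (λ i → binomialTerm y (N ∸ μ) (ν i)))
    ≡⟨ sumTo-cong a (λ μ → *-distribˡ-sumTo a (+ (N C μ)) _) ⟩
  sumTo a (λ μ → sumTo a (λ i → + (N C μ) * binomialTerm y (N ∸ μ) (ν i)))
    ≡⟨ sumTo-swap a a _ ⟩
  sumTo a (λ i → sumTo a (λ μ → + (N C μ) * binomialTerm y (N ∸ μ) (ν i)))
    ≡⟨ sumTo-cong a (λ i → sumTo-cong a (λ μ → trinomial-sym y N μ (ν i))) ⟩
  sumTo a (λ i → sumTo a (λ μ → + (N C ν i) * binomialTerm y (N ∸ ν i) μ))
    ≡⟨ sumTo-cong a (λ i → *-distribˡ-sumTo a (+ (N C ν i)) _) ⟨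
  sumTo a (λ i → + (N C ν i) * sumTo a (binomialTerm y (N ∸ ν i)))
    ≡⟨ sumTo-cong a (λ i → cong (+ (N C ν i) *_) (binomial-sumTo y (N ∸ ν i) a (N∸ν≤a i))) ⟩
  sumTo a (λ i → binomialTerm (+ 1 + y) N (ν i)) ∎
  where
  ν : ℕ → ℕ
  ν i = suc (b +ℕ i)
  N∸ν≤a : ∀ i → N ∸ ν i ≤ a
  N∸ν≤a i = ℕₚ.m≤n+o⇒m∸n≤o N (ν i) (ℕₚ.≤-trans N≤1+a+b
    (s≤s (ℕₚ.≤-trans (ℕₚ.≤-reflexive (ℕₚ.+-comm a b)) (ℕₚ.+-monoˡ-≤ a (ℕₚ.m≤m+n b i)))))

truncatedDoubleSum : ℕ → ℕ → ℕ → ℤ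
truncatedDoubleSum N a b = sumTo a (λ μ → + (N C μ) * sumTo b (binomialTerm (- (+ 2)) (N ∸ μ)))

truncatedDoubleSum-closedForm : ∀ a b → truncatedDoubleSum (suc (a +ℕ b)) a b
  ≡ - binomialTerm (- (+ 1)) (a +ℕ b) a - binomialTerm (- (+ 1)) (a +ℕ b) b
truncatedDoubleSum-closedForm a b = begin
  S
    ≡⟨ rearrange S T Qb ⟩
  (S + T) - (Qb + T) + Qb
    ≡⟨ cong₂ (λ p q → p - q + Qb) completed (trans (cong (λ x → Qb + x) T≡X) complete-alternating) ⟩
  - B a - + 0 + Qb
    ≡⟨ cong (λ q → - B a - + 0 + q) (alternating-sumTo n b) ⟩
  - B a - + 0 + - B b
    ≡⟨ tidy (B a) (B b) ⟩
  - B a - B b ∎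
  where
  n N : ℕ
  n = a +ℕ b
  N = suc n
  m1 t : ℤ
  m1 = - (+ 1)
  t = - (+ 2)
  B : ℕ → ℤ
  B = binomialTerm m1 n
  tail : ℕ → ℤ
  tail μ = sumTo a (λ i → binomialTerm t (N ∸ μ) (suc (b +ℕ i)))
  S T X Qb : ℤ
  S = truncatedDoubleSum N a b
  T = sumTo a (λ μ → + (N C μ) * tail μ)
  X = sumTo a (λ i → binomialTerm m1 N (suc (b +ℕ i)))
  Qb = sumTo b (binomialTerm m1 N)
  N≡1+b+a : N ≡ suc (b +ℕ a)
  N≡1+b+a = cong suc (ℕₚ.+-comm a b)
  inner-completed : ∀ μ → sumTo b (binomialTerm t (N ∸ μ)) + tail μ ≡ m1 ^ᶻ (N ∸ μ)
  inner-completed μ = trans (sym (sumTo-split b a _))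
    (binomial-sumTo t (N ∸ μ) (suc (b +ℕ a)) (ℕₚ.≤-trans (ℕₚ.m∸n≤m N μ) (ℕₚ.≤-reflexive N≡1+b+a)))
  completed : S + T ≡ - B a
  completed = begin
    S + T
      ≡⟨ sumTo-distrib-+ a _ _ ⟨
    sumTo a (λ μ → + (N C μ) * sumTo b (binomialTerm t (N ∸ μ)) + + (N C μ) * tail μ)
      ≡⟨ sumTo-cong a (λ μ → ℤₚ.*-distribˡ-+ (+ (N C μ)) _ _) ⟨
    sumTo a (λ μ → + (N C μ) * (sumTo b (binomialTerm t (N ∸ μ)) + tail μ))
      ≡⟨ sumTo-cong a (λ μ → cong (+ (N C μ) *_) (inner-completed μ)) ⟩
    sumTo a (binomialTerm m1 N)
      ≡⟨ alternating-sumTo n a ⟩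
    - B a ∎
  T≡X : T ≡ X
  T≡X = binomial-tail-swap t N a b ℕₚ.≤-refl
  complete-alternating : Qb + X ≡ + 0
  complete-alternating = trans (sym (sumTo-split b a _))
    (binomial-sumTo m1 N (suc (b +ℕ a)) (ℕₚ.≤-reflexive N≡1+b+a))
  rearrange : ∀ s t q → s ≡ (s + t) - (q + t) + q
  rearrange = solve-∀
  tidy : ∀ x y → - x - + 0 + - y ≡ - x - y
  tidy = solve-∀

sign-identity : ∀ p q c → p * p ≡ + 1 → - (c * (p * q)) - c * q ≡ - (+ 1) * (p * q) * c * (+ 1 + p)
sign-identity p q c p*p≡1 = begin
  - (c * (p * q)) - c * q               ≡⟨ cong (λ x → - (c * (p * q)) - c * x) q≡p*p*q ⟩
  - (c * (p * q)) - c * (p * p * q)     ≡⟨ factor p q c ⟩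
  - (+ 1) * (p * q) * c * (+ 1 + p)     ∎
  where
  q≡p*p*q : q ≡ p * p * q
  q≡p*p*q = trans (sym (ℤₚ.*-identityˡ q)) (cong (_* q) (sym p*p≡1))
  factor : ∀ p q c → - (c * (p * q)) - c * (p * p * q) ≡ - (+ 1) * (p * q) * c * (+ 1 + p)
  factor = solve-∀

2j∸u≡[j∸u]+j : ∀ {j u} → u ≤ j → 2 *ℕ j ∸ u ≡ (j ∸ u) +ℕ j
2j∸u≡[j∸u]+j {j} {u} u≤j = begin
  2 *ℕ j                      ∸ u ≡⟨ cong (λ k → j +ℕ k ∸ u) (ℕₚ.+-identityʳ j) ⟩
  j +ℕ j                      ∸ u ≡⟨ cong (λ k → k +ℕ j ∸ u) (ℕₚ.m+[n∸m]≡n u≤j) ⟨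
  u +ℕ (j ∸ u) +ℕ j           ∸ u ≡⟨ cong (_∸ u) (ℕₚ.+-assoc u (j ∸ u) j) ⟩
  u +ℕ ((j ∸ u) +ℕ j)         ∸ u ≡⟨ ℕₚ.m+n∸m≡n u ((j ∸ u) +ℕ j) ⟩
  (j ∸ u) +ℕ j                    ∎

2j+1∸u≡1+[j∸u]+j : ∀ {j u} → u ≤ j → 2 *ℕ j +ℕ 1 ∸ u ≡ suc ((j ∸ u) +ℕ j)
2j+1∸u≡1+[j∸u]+j {j} {u} u≤j = begin
  2 *ℕ j +ℕ 1 ∸ u       ≡⟨ ℕₚ.+-∸-comm 1 (ℕₚ.≤-trans u≤j (ℕₚ.m≤m+n j _)) ⟩
  (2 *ℕ j ∸ u) +ℕ 1     ≡⟨ cong (_+ℕ 1) (2j∸u≡[j∸u]+j u≤j) ⟩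
  (j ∸ u) +ℕ j +ℕ 1     ≡⟨ ℕₚ.+-comm ((j ∸ u) +ℕ j) 1 ⟩
  suc ((j ∸ u) +ℕ j)    ∎

alternating-pair : ∀ {j u} → u ≤ j →
  - binomialTerm (- (+ 1)) ((j ∸ u) +ℕ j) (j ∸ u) - binomialTerm (- (+ 1)) ((j ∸ u) +ℕ j) j
  ≡ (- (+ 1)) ^ᶻ suc j * + (((j ∸ u) +ℕ j) C j) * (+ 1 + (- (+ 1)) ^ᶻ u)
alternating-pair {j} {u} u≤j = begin
  - binomialTerm m1 (a +ℕ j) a - binomialTerm m1 (a +ℕ j) j
    ≡⟨ cong₂ (λ x y → - x - y)
             (cong₂ _*_ (cong +_ C-sym) (trans (cong (m1 ^ᶻ_) (ℕₚ.m+n∸m≡n a j)) m1^j≡p*q))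
             (cong (c *_) (cong (m1 ^ᶻ_) (ℕₚ.m+n∸n≡m a j))) ⟩
  - (c * (p * q)) - c * q
    ≡⟨ sign-identity p q c (-1^n*-1^n≡1 u) ⟩
  m1 * (p * q) * c * (+ 1 + p)
    ≡⟨ cong (λ x → m1 * x * c * (+ 1 + p)) m1^j≡p*q ⟨
  m1 ^ᶻ suc j * c * (+ 1 + p) ∎
  where
  a : ℕ
  a = j ∸ u
  m1 p q c : ℤ
  m1 = - (+ 1)
  p = m1 ^ᶻ u
  q = m1 ^ᶻ a
  c = + ((a +ℕ j) C j)
  C-sym : (a +ℕ j) C a ≡ (a +ℕ j) C j
  C-sym = trans (nCk≡nC[n∸k] (ℕₚ.m≤m+n a j)) (cong ((a +ℕ j) C_) (ℕₚ.m+n∸m≡n a j))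
  m1^j≡p*q : m1 ^ᶻ j ≡ p * q
  m1^j≡p*q = trans (cong (m1 ^ᶻ_) (sym (ℕₚ.m+[n∸m]≡n u≤j))) (^ᶻ-distribˡ-+-* m1 u a)

mainTheorem2 : ∀ (j u : ℕ) → j Data.Nat.≥ u →
    sumTo (j ∸ u) (λ μ → (+ ((2 Data.Nat.* j Data.Nat.+ 1 ∸ u) C μ)) *
      sumTo j (λ ν → (+ ((2 Data.Nat.* j Data.Nat.+ 1 ∸ u ∸ μ) C ν)) *
        ((- (+ 2)) ^ᶻ (2 Data.Nat.* j Data.Nat.+ 1 ∸ u ∸ μ ∸ ν))))
    ≡ ((- (+ 1)) ^ᶻ (Data.Nat.suc j)) * (+ ((2 Data.Nat.* j ∸ u) C j)) * (+ 1 + ((- (+ 1)) ^ᶻ u))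
mainTheorem2 j u u≤j = begin
  truncatedDoubleSum (2 *ℕ j +ℕ 1 ∸ u) (j ∸ u) j
    ≡⟨ cong (λ N → truncatedDoubleSum N (j ∸ u) j) (2j+1∸u≡1+[j∸u]+j u≤j) ⟩
  truncatedDoubleSum (suc ((j ∸ u) +ℕ j)) (j ∸ u) j
    ≡⟨ truncatedDoubleSum-closedForm (j ∸ u) j ⟩
  - binomialTerm (- (+ 1)) ((j ∸ u) +ℕ j) (j ∸ u) - binomialTerm (- (+ 1)) ((j ∸ u) +ℕ j) j
    ≡⟨ alternating-pair u≤j ⟩
  (- (+ 1)) ^ᶻ suc j * + (((j ∸ u) +ℕ j) C j) * (+ 1 + (- (+ 1)) ^ᶻ u)
    ≡⟨ cong (λ n → (- (+ 1)) ^ᶻ suc j * + (n C j) * (+ 1 + (- (+ 1)) ^ᶻ u)) (2j∸u≡[j∸u]+j u≤j) ⟨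
  (- (+ 1)) ^ᶻ suc j * + ((2 *ℕ j ∸ u) C j) * (+ 1 + (- (+ 1)) ^ᶻ u) ∎
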